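{- Let $E$ be a finite set with $N\ge2$ elements and let $d\ge2$. For any map $\varphi:E^{d-2}\to\mathrm{Perm}_E$, $z\mapsto\varphi_z$, the set $$\mathcal M=\{\alpha_1\alpha_2\cdots\alpha_{d-1}\alpha_d\in E^d : \varphi_{\alpha_2\alpha_3\cdots\alpha_{d-1}}(\alpha_1)=\alpha_d\}$$ is a mock parity check set of length $d$, and every mock parity check set of length $d$ in $E^d$ is of this form for some such map $\varphi$.
   Context: $E^d$ denotes the set of words of length $d$ with letters in $E$, and $\mathrm{Perm}_E$ the group of permutations of $E$. For words $w=\alpha_0\alpha_1\cdots\alpha_{d-1}$ and $w'=\alpha_1\cdots\alpha_{d-1}\alpha_d$ in $E^d$, $w'$ is an immediate successor of $w$ and $w$ an immediate predecessor of $w'$. A mock parity check set (MPCS) of length $d$ is a subset $\mathcal M\subset E^d$ such that (i) each element of $\mathcal M$ has a unique immediate successor in $\mathcal M$ and a unique immediate predecessor in $\mathcal M$, and (ii) $\mathcal M$ has exactly $N^{d-1}$ elements. -}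

module Defs where

open import Data.Nat using (ℕ; zero; suc; _∸_; _^_)
open import Data.Bool using (Bool; true; false)
open import Data.Fin using (Fin)
open import Data.Fin.Properties using (_≟_)
open import Data.Fin.Permutation using (Permutation′; _⟨$⟩ʳ_)
open import Data.Vec using (Vec; []; _∷_; _∷ʳ_; init; last)
open import Data.List using (List; [_]; map; concatMap; allFin; filterᵇ; length)
open import Data.Product using (Σ; ∃; _×_)
open import Relation.Binary.PropositionalEquality using (_≡_)
open import Relation.Nullary.Decidable using (⌊_⌋)

Word : ℕ → ℕ → Set
Word N d = Vec (Fin N) d

WordSet : ℕ → ℕ → Set
WordSet N d = Word N d → Bool

-- w' is an immediate successor of w :
--   w = α₀ α₁ … α_{d-1}, w' = α₁ … α_{d-1} α_d, i.e. w ∷ʳ α_d ≡ α₀ ∷ w'.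
ImmSucc : ∀ {N d} → Word N d → Word N d → Set
ImmSucc {N} w w' = Σ (Fin N) λ α₀ → Σ (Fin N) λ αd → w ∷ʳ αd ≡ α₀ ∷ w'

_∈ₛ_ : ∀ {N d} → Word N d → WordSet N d → Set
w ∈ₛ M = M w ≡ true

allWords : ∀ N d → List (Word N d)
allWords N zero = [ [] ]
allWords N (suc d) = concatMap (λ a → map (a ∷_) (allWords N d)) (allFin N)

card : ∀ {N d} → WordSet N d → ℕ
card {N} {d} M = length (filterᵇ M (allWords N d))

record IsMPCS {N d : ℕ} (M : WordSet N d) : Set where
  field
    succ-exists : ∀ w → w ∈ₛ M → ∃ λ w' → w' ∈ₛ M × ImmSucc w w'
    succ-unique : ∀ w w₁ w₂ → w ∈ₛ M → w₁ ∈ₛ M → w₂ ∈ₛ M →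
                  ImmSucc w w₁ → ImmSucc w w₂ → w₁ ≡ w₂
    pred-exists : ∀ w' → w' ∈ₛ M → ∃ λ w → w ∈ₛ M × ImmSucc w w'
    pred-unique : ∀ w' w₁ w₂ → w' ∈ₛ M → w₁ ∈ₛ M → w₂ ∈ₛ M →
                  ImmSucc w₁ w' → ImmSucc w₂ w' → w₁ ≡ w₂
    cardinality : card M ≡ N ^ (d ∸ 1)

-- The set  { α₁ α₂ … α_{d-1} α_d : φ_{α₂…α_{d-1}}(α₁) = α_d }  for d ≥ 2
-- (for d < 2 it is the empty set; this case never arises in the statement).
Mφ : ∀ {N} d → (Word N (d ∸ 2) → Permutation′ N) → WordSet N d
Mφ zero φ w = false
Mφ (suc zero) φ w = false
Mφ (suc (suc k)) φ (α₁ ∷ rest) = ⌊ (φ (init rest) ⟨$⟩ʳ α₁) ≟ last rest ⌋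

{-# OPTIONS --safe #-}
-- Write a word of length d both as a·q and as p·c with a, c letters.  In an MPCS M,
-- two left extensions a·q, b·q ∈ M are predecessors of the successor of a·q, so each
-- word q of length d-1 has at most one left extension in M; symmetrically each p has
-- at most one right extension p·c ∈ M.  The numbers of left extensions are therefore
-- ≤ 1, and they sum to |M| = N^(d-1), the number of words q, so every q has exactly
-- one; the successor of that a·q extends p = q to the right.  Conversely, a set in
-- which every word of length d-1 extends uniquely on both sides is an MPCS, by the
-- same count.  For p = a·z and q = z·c the two extension maps a ↦ c and c ↦ a are
-- mutually inverse, which gives the permutations φ_z, and such a set is determined
-- by its right extensions.
module Submission where

open import Defs
open import Data.Nat using (ℕ; zero; suc; _+_; _*_; _∸_; _^_; _≤_; z≤n; s≤s)
open import Data.Nat.Properties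
  using (+-0-commutativeMonoid; ≤-antisym; ≤-trans; ≤-reflexive; m≤n+m; ≮⇒≥;
         m+n≡0⇒m≡0; m+n≡0⇒n≡0; +-cancelʳ-≡; m∸n+n≡m; m∸n≡0⇒m≤n)
open import Algebra.Properties.CommutativeMonoid.Sum +-0-commutativeMonoid
  using (sum-syntax; sum-cong-≗; ∑-comm; ∑-distrib-+)
open import Data.Bool using (Bool; true; false)
open import Data.Bool.Properties using (T-≡; ⇔→≡)
open import Data.Fin using (Fin; zero; suc)
open import Data.Fin.Properties using (_≟_; suc-injective; 0≢1+n)
open import Data.Fin.Permutation using (Permutation′; _⟨$⟩ʳ_; _⟨$⟩ˡ_; permutation; inverseʳ)
open import Data.Vec using (Vec; []; _∷_; _∷ʳ_; initLast)
open import Data.Vec.Properties using (∷-injective; ∷ʳ-injectiveˡ; ∷ʳ-injectiveʳ; init-∷ʳ; last-∷ʳ)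
open import Data.List using (List; []; _∷_; _++_; map; concat; tabulate; filterᵇ; length)
open import Data.List.Properties using (filter-++; length-++; map-tabulate)
open import Data.Product using (∃; _×_; _,_; proj₁; proj₂)
open import Function using (_⇔_; mk⇔; Equivalence; Injection; id; _∘_)
open import Function.Properties.Inverse using (↔⇒↣)
open import Relation.Nullary.Decidable using (toWitness; fromWitness; T?)
open import Relation.Binary.PropositionalEquality using (_≡_; refl; sym; trans; cong; subst; module ≡-Reasoning)

open ≡-Reasoning

toℕ : Bool → ℕ
toℕ false = 0
toℕ true  = 1

∑-const : ∀ n c → ∑[ i < n ] c ≡ n * c
∑-const zero    c = refl
∑-const (suc n) c = cong (c +_) (∑-const n c)

∑≡0⇒≡0 : ∀ {n} (f : Fin n → ℕ) → ∑[ i < n ] f i ≡ 0 → ∀ i → f i ≡ 0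
∑≡0⇒≡0 f ∑≡0 zero    = m+n≡0⇒m≡0 (f zero) ∑≡0
∑≡0⇒≡0 f ∑≡0 (suc i) = ∑≡0⇒≡0 (f ∘ suc) (m+n≡0⇒n≡0 (f zero) ∑≡0) i

≡true⇒1≤∑toℕ : ∀ {n} (p : Fin n → Bool) {i} → p i ≡ true → 1 ≤ ∑[ j < n ] toℕ (p j)
≡true⇒1≤∑toℕ p {zero}  pi≡true rewrite pi≡true = s≤s z≤n
≡true⇒1≤∑toℕ p {suc i} pi≡true = ≤-trans (≡true⇒1≤∑toℕ (p ∘ suc) pi≡true) (m≤n+m _ (toℕ (p zero)))

1≤∑toℕ⇒∃ : ∀ {n} (p : Fin n → Bool) → 1 ≤ ∑[ i < n ] toℕ (p i) → ∃ λ i → p i ≡ true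
1≤∑toℕ⇒∃ {suc n} p 1≤∑ with p zero in p0
... | true  = zero , p0
... | false = let i , pi≡true = 1≤∑toℕ⇒∃ (p ∘ suc) 1≤∑ in suc i , pi≡true

∑toℕ≤1 : ∀ {n} (p : Fin n → Bool) → (∀ {i j} → p i ≡ true → p j ≡ true → i ≡ j) →
         ∑[ i < n ] toℕ (p i) ≤ 1
∑toℕ≤1 {zero}  p unique = z≤n
∑toℕ≤1 {suc n} p unique with p zero in p0
... | false = ∑toℕ≤1 (p ∘ suc) (λ pi pj → suc-injective (unique pi pj))
... | true  = s≤s (≮⇒≥ λ 1≤∑ → let i , pi≡true = 1≤∑toℕ⇒∃ (p ∘ suc) 1≤∑ in 0≢1+n (unique p0 pi≡true))

∑ʷ : ∀ {N} d → (Word N d → ℕ) → ℕ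
∑ʷ     zero    f = f []
∑ʷ {N} (suc d) f = ∑[ a < N ] ∑ʷ d (λ w → f (a ∷ w))

module _ {N : ℕ} where

  ∑ʷ-cong : ∀ d {f g : Word N d → ℕ} → (∀ w → f w ≡ g w) → ∑ʷ d f ≡ ∑ʷ d g
  ∑ʷ-cong zero    f≗g = f≗g []
  ∑ʷ-cong (suc d) f≗g = sum-cong-≗ (λ a → ∑ʷ-cong d (f≗g ∘ (a ∷_)))

  ∑ʷ-comm : ∀ d {n} (f : Fin n → Word N d → ℕ) →
            ∑ʷ d (λ w → ∑[ i < n ] f i w) ≡ ∑[ i < n ] ∑ʷ d (f i)
  ∑ʷ-comm zero    f = refl
  ∑ʷ-comm (suc d) f = trans (sum-cong-≗ (λ a → ∑ʷ-comm d (λ i w → f i (a ∷ w))))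
                            (∑-comm (λ a i → ∑ʷ d (λ w → f i (a ∷ w))))

  ∑ʷ-distrib-+ : ∀ d (f g : Word N d → ℕ) → ∑ʷ d (λ w → f w + g w) ≡ ∑ʷ d f + ∑ʷ d g
  ∑ʷ-distrib-+ zero    f g = refl
  ∑ʷ-distrib-+ (suc d) f g = trans (sum-cong-≗ (λ a → ∑ʷ-distrib-+ d (f ∘ (a ∷_)) (g ∘ (a ∷_))))
    (∑-distrib-+ (λ a → ∑ʷ d (f ∘ (a ∷_))) (λ a → ∑ʷ d (g ∘ (a ∷_))))

  ∑ʷ-one : ∀ d → ∑ʷ {N} d (λ _ → 1) ≡ N ^ d
  ∑ʷ-one zero    = refl
  ∑ʷ-one (suc d) = trans (sum-cong-≗ {N} (λ _ → ∑ʷ-one d)) (∑-const N (N ^ d))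

  ∑ʷ≡0⇒≡0 : ∀ d (f : Word N d → ℕ) → ∑ʷ d f ≡ 0 → ∀ w → f w ≡ 0
  ∑ʷ≡0⇒≡0 zero    f ∑≡0 []      = ∑≡0
  ∑ʷ≡0⇒≡0 (suc d) f ∑≡0 (a ∷ w) = ∑ʷ≡0⇒≡0 d _ (∑≡0⇒≡0 _ ∑≡0 a) w

  ∑ʷ-≤-≡⇒≡ : ∀ d {f g : Word N d → ℕ} → (∀ w → f w ≤ g w) → ∑ʷ d f ≡ ∑ʷ d g →
             ∀ w → f w ≡ g w
  ∑ʷ-≤-≡⇒≡ d {f} {g} f≤g ∑f≡∑g w =
    ≤-antisym (f≤g w) (m∸n≡0⇒m≤n (∑ʷ≡0⇒≡0 d _ ∑gap≡0 w))
    where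
    ∑gap≡0 : ∑ʷ d (λ w → g w ∸ f w) ≡ 0
    ∑gap≡0 = +-cancelʳ-≡ (∑ʷ d f) _ 0 (begin
      ∑ʷ d (λ w → g w ∸ f w) + ∑ʷ d f  ≡⟨ ∑ʷ-distrib-+ d _ f ⟨
      ∑ʷ d (λ w → g w ∸ f w + f w)     ≡⟨ ∑ʷ-cong d (λ w → m∸n+n≡m (f≤g w)) ⟩
      ∑ʷ d g                           ≡⟨ ∑f≡∑g ⟨
      ∑ʷ d f                           ∎)

length-filterᵇ-map : ∀ {A B : Set} (p : B → Bool) (f : A → B) xs →
                     length (filterᵇ p (map f xs)) ≡ length (filterᵇ (p ∘ f) xs)
length-filterᵇ-map p f []       = refl
length-filterᵇ-map p f (x ∷ xs) with p (f x)
... | true  = cong suc (length-filterᵇ-map p f xs)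
... | false = length-filterᵇ-map p f xs

length-filterᵇ-concat : ∀ {A : Set} (p : A → Bool) {n} (xss : Fin n → List A) →
  length (filterᵇ p (concat (tabulate xss))) ≡ ∑[ i < n ] length (filterᵇ p (xss i))
length-filterᵇ-concat p {zero}  xss = refl
length-filterᵇ-concat p {suc n} xss = begin
  length (filterᵇ p (xss zero ++ rest))           ≡⟨ cong length (filter-++ (T? ∘ p) (xss zero) rest) ⟩
  length (filterᵇ p (xss zero) ++ filterᵇ p rest) ≡⟨ length-++ (filterᵇ p (xss zero)) ⟩
  length (filterᵇ p (xss zero)) + length (filterᵇ p rest)
    ≡⟨ cong (length (filterᵇ p (xss zero)) +_) (length-filterᵇ-concat p (xss ∘ suc)) ⟩
  ∑[ i < suc n ] length (filterᵇ p (xss i))            ∎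
  where rest = concat (tabulate (xss ∘ suc))

card≡∑ʷ : ∀ {N} d (M : WordSet N d) → card M ≡ ∑ʷ d (toℕ ∘ M)
card≡∑ʷ zero M with M []
... | true  = refl
... | false = refl
card≡∑ʷ {N} (suc d) M = begin
  length (filterᵇ M (concat (map extend (tabulate id))))
    ≡⟨ cong (length ∘ filterᵇ M ∘ concat) (map-tabulate id extend) ⟩
  length (filterᵇ M (concat (tabulate extend)))
    ≡⟨ length-filterᵇ-concat M extend ⟩
  ∑[ a < N ] length (filterᵇ M (extend a))
    ≡⟨ sum-cong-≗ {N} (λ a → trans (length-filterᵇ-map M (a ∷_) (allWords N d))
                                   (card≡∑ʷ d (M ∘ (a ∷_)))) ⟩
  ∑ʷ (suc d) (toℕ ∘ M)
    ∎
  where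
  extend : Fin N → List (Word N (suc d))
  extend a = map (a ∷_) (allWords N d)

∀-∷ʳ : ∀ {A : Set} {n} (P : Vec A (suc n) → Set) → (∀ xs x → P (xs ∷ʳ x)) → ∀ ys → P ys
∀-∷ʳ P P-∷ʳ ys with xs , x , refl ← initLast ys = P-∷ʳ xs x

#extendˡ : ∀ {N d} → WordSet N (suc d) → Word N d → ℕ
#extendˡ {N} M q = ∑[ a < N ] toℕ (M (a ∷ q))

card≡∑ʷ-#extendˡ : ∀ {N d} (M : WordSet N (suc d)) → card M ≡ ∑ʷ d (#extendˡ M)
card≡∑ʷ-#extendˡ {N} {d} M = trans (card≡∑ʷ (suc d) M) (sym (∑ʷ-comm d (λ a q → toℕ (M (a ∷ q)))))

record UniquelyExtendable {N d} (M : WordSet N (suc d)) : Set where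
  field
    extendˡ        : ∀ q → ∃ λ a → (a ∷ q) ∈ₛ M
    extendˡ-unique : ∀ {a b q} → (a ∷ q) ∈ₛ M → (b ∷ q) ∈ₛ M → a ≡ b
    extendʳ        : ∀ p → ∃ λ c → (p ∷ʳ c) ∈ₛ M
    extendʳ-unique : ∀ {p c c′} → (p ∷ʳ c) ∈ₛ M → (p ∷ʳ c′) ∈ₛ M → c ≡ c′

module _ {N d : ℕ} {M : WordSet N (suc d)} (ue : UniquelyExtendable M) where
  open UniquelyExtendable ue

  uniquelyExtendable⇒isMPCS : IsMPCS M
  uniquelyExtendable⇒isMPCS = record
    { succ-exists = succ-exists
    ; succ-unique = succ-unique
    ; pred-exists = pred-exists
    ; pred-unique = pred-unique
    ; cardinality = begin
        card M             ≡⟨ card≡∑ʷ-#extendˡ M ⟩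
        ∑ʷ d (#extendˡ M)  ≡⟨ ∑ʷ-cong d #extendˡ≡1 ⟩
        ∑ʷ d (λ _ → 1)     ≡⟨ ∑ʷ-one d ⟩
        N ^ d              ∎
    }
    where
    succ-exists : ∀ w → w ∈ₛ M → ∃ λ w′ → w′ ∈ₛ M × ImmSucc w w′
    succ-exists (a ∷ u) _ = let c , m = extendʳ u in u ∷ʳ c , m , a , c , refl

    succ-unique : ∀ w w₁ w₂ → w ∈ₛ M → w₁ ∈ₛ M → w₂ ∈ₛ M → ImmSucc w w₁ → ImmSucc w w₂ → w₁ ≡ w₂
    succ-unique (a ∷ u) _ _ _ m₁ m₂ (_ , _ , refl) (_ , _ , refl) = cong (u ∷ʳ_) (extendʳ-unique m₁ m₂)

    pred-exists : ∀ w′ → w′ ∈ₛ M → ∃ λ w → w ∈ₛ M × ImmSucc w w′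
    pred-exists w′ _ with u , c , refl ← initLast w′ = let a , m = extendˡ u in a ∷ u , m , a , c , refl

    pred-unique : ∀ w′ w₁ w₂ → w′ ∈ₛ M → w₁ ∈ₛ M → w₂ ∈ₛ M → ImmSucc w₁ w′ → ImmSucc w₂ w′ → w₁ ≡ w₂
    pred-unique _ (a₁ ∷ u₁) (a₂ ∷ u₂) _ m₁ m₂ (_ , _ , refl) (_ , _ , u₂c₂≡u₁c₁)
      with refl ← ∷ʳ-injectiveˡ u₂ u₁ (proj₂ (∷-injective u₂c₂≡u₁c₁))
      = cong (_∷ u₁) (extendˡ-unique m₁ m₂)

    #extendˡ≡1 : ∀ q → #extendˡ M q ≡ 1
    #extendˡ≡1 q = ≤-antisym (∑toℕ≤1 (λ a → M (a ∷ q)) extendˡ-unique)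
                             (≡true⇒1≤∑toℕ (λ a → M (a ∷ q)) (proj₂ (extendˡ q)))

module _ {N d : ℕ} {M : WordSet N (suc d)} (isM : IsMPCS M) where
  open IsMPCS isM

  isMPCS⇒uniquelyExtendable : UniquelyExtendable M
  isMPCS⇒uniquelyExtendable = record
    { extendˡ        = extendˡ
    ; extendˡ-unique = extendˡ-unique
    ; extendʳ        = extendʳ
    ; extendʳ-unique = extendʳ-unique
    }
    where
    extendˡ-unique : ∀ {a b q} → (a ∷ q) ∈ₛ M → (b ∷ q) ∈ₛ M → a ≡ b
    extendˡ-unique {a} {b} {q} ma mb with succ-exists (a ∷ q) ma
    ... | _ , m′ , _ , c , refl =
      proj₁ (∷-injective (pred-unique (q ∷ʳ c) (a ∷ q) (b ∷ q) m′ ma mb (a , c , refl) (b , c , refl)))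

    extendʳ-unique : ∀ {p c c′} → (p ∷ʳ c) ∈ₛ M → (p ∷ʳ c′) ∈ₛ M → c ≡ c′
    extendʳ-unique {p} {c} {c′} m m′ with pred-exists (p ∷ʳ c) m
    ... | b ∷ u , mb , _ , _ , uc₀≡pc with refl ← ∷ʳ-injectiveˡ u p (proj₂ (∷-injective uc₀≡pc)) =
      ∷ʳ-injectiveʳ p p (succ-unique (b ∷ p) (p ∷ʳ c) (p ∷ʳ c′) mb m m′ (b , c , refl) (b , c′ , refl))

    #extendˡ≡1 : ∀ q → #extendˡ M q ≡ 1
    #extendˡ≡1 = ∑ʷ-≤-≡⇒≡ d (λ q → ∑toℕ≤1 (λ a → M (a ∷ q)) extendˡ-unique) (begin
      ∑ʷ d (#extendˡ M)  ≡⟨ card≡∑ʷ-#extendˡ M ⟨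
      card M             ≡⟨ cardinality ⟩
      N ^ d              ≡⟨ ∑ʷ-one d ⟨
      ∑ʷ d (λ _ → 1)     ∎)

    extendˡ : ∀ q → ∃ λ a → (a ∷ q) ∈ₛ M
    extendˡ q = 1≤∑toℕ⇒∃ (λ a → M (a ∷ q)) (≤-reflexive (sym (#extendˡ≡1 q)))

    extendʳ : ∀ p → ∃ λ c → (p ∷ʳ c) ∈ₛ M
    extendʳ p with a , m ← extendˡ p with succ-exists (a ∷ p) m
    ... | _ , m′ , _ , c , refl = c , m′

module _ {N k : ℕ} where

  ∈Mφ⇔ : ∀ (φ : Word N k → Permutation′ N) a z c →
         (a ∷ (z ∷ʳ c)) ∈ₛ Mφ (suc (suc k)) φ ⇔ φ z ⟨$⟩ʳ a ≡ c
  ∈Mφ⇔ φ a z c rewrite init-∷ʳ c z | last-∷ʳ c z =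
    mk⇔ (toWitness {a? = φ z ⟨$⟩ʳ a ≟ c} ∘ Equivalence.from T-≡) (Equivalence.to T-≡ ∘ fromWitness)

  Mφ-uniquelyExtendable : ∀ φ → UniquelyExtendable (Mφ (suc (suc k)) φ)
  Mφ-uniquelyExtendable φ = record
    { extendˡ        = ∀-∷ʳ (λ q → ∃ λ a → (a ∷ q) ∈ₛ M) λ z c →
                         φ z ⟨$⟩ˡ c , Equivalence.from (∈Mφ⇔ φ _ z c) (inverseʳ (φ z))
    ; extendˡ-unique = λ {a} {b} {q} → ∀-∷ʳ (λ q → (a ∷ q) ∈ₛ M → (b ∷ q) ∈ₛ M → a ≡ b)
                         (λ z c ma mb → Injection.injective (↔⇒↣ (φ z))
                                          (trans (to (∈Mφ⇔ φ a z c) ma) (sym (to (∈Mφ⇔ φ b z c) mb)))) q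
    ; extendʳ        = λ { (a ∷ z) → φ z ⟨$⟩ʳ a , from (∈Mφ⇔ φ a z _) refl }
    ; extendʳ-unique = λ { {a ∷ z} m m′ → trans (sym (to (∈Mφ⇔ φ a z _) m)) (to (∈Mφ⇔ φ a z _) m′) }
    }
    where
    open Equivalence using (to; from)
    M = Mφ (suc (suc k)) φ

⊆⇒≗ : ∀ {N d} {M M′ : WordSet N (suc d)} → UniquelyExtendable M → UniquelyExtendable M′ →
      (∀ w → w ∈ₛ M → w ∈ₛ M′) → ∀ w → M w ≡ M′ w
⊆⇒≗ {M = M} ue ue′ M⊆M′ = ∀-∷ʳ (λ w → M w ≡ _) λ p c →
  ⇔→≡ (mk⇔ (M⊆M′ (p ∷ʳ c)) λ m′ →
    let c₀ , m = extendʳ ue p in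
    subst (λ x → (p ∷ʳ x) ∈ₛ M) (extendʳ-unique ue′ (M⊆M′ (p ∷ʳ c₀) m) m′) m)
  where open UniquelyExtendable

module _ {N k : ℕ} {M : WordSet N (suc (suc k))} (ue : UniquelyExtendable M) where
  open UniquelyExtendable ue

  permutations : Word N k → Permutation′ N
  permutations z = permutation next prev next∘prev prev∘next
    where
    next : Fin N → Fin N
    next a = proj₁ (extendʳ (a ∷ z))

    prev : Fin N → Fin N
    prev c = proj₁ (extendˡ (z ∷ʳ c))

    next∘prev : ∀ c → next (prev c) ≡ c
    next∘prev c =
      extendʳ-unique {p = prev c ∷ z} (proj₂ (extendʳ (prev c ∷ z))) (proj₂ (extendˡ (z ∷ʳ c)))

    prev∘next : ∀ a → prev (next a) ≡ a
    prev∘next a = extendˡ-unique (proj₂ (extendˡ (z ∷ʳ next a))) (proj₂ (extendʳ (a ∷ z)))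

  M⊆Mφ : ∀ w → w ∈ₛ M → w ∈ₛ Mφ (suc (suc k)) permutations
  M⊆Mφ (a ∷ q) = ∀-∷ʳ (λ q → (a ∷ q) ∈ₛ M → (a ∷ q) ∈ₛ Mφ (suc (suc k)) permutations)
    (λ z c m → Equivalence.from (∈Mφ⇔ permutations a z c)
                 (extendʳ-unique {p = a ∷ z} (proj₂ (extendʳ (a ∷ z))) m)) q

proposition2p13 : (N : ℕ) → 2 ≤ N → (d : ℕ) → 2 ≤ d →
    ((φ : Word N (d ∸ 2) → Permutation′ N) → IsMPCS (Mφ d φ))
    × ((M : WordSet N d) → IsMPCS M →
    ∃ λ (φ : Word N (d ∸ 2) → Permutation′ N) → ∀ w → M w ≡ Mφ d φ w)
proposition2p13 N _ (suc (suc k)) (s≤s (s≤s _)) =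
  (λ φ → uniquelyExtendable⇒isMPCS (Mφ-uniquelyExtendable φ)) ,
  λ M isM → let ue = isMPCS⇒uniquelyExtendable isM in
    permutations ue , ⊆⇒≗ ue (Mφ-uniquelyExtendable _) (M⊆Mφ ue)
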